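{- Let $m\geq 1$ and $\mathbf{z}=(z_1,\ldots,z_m)\in\mathbb{N}^m$. Consider the alphabet $\Gamma=\{a,b_1,\ldots,b_m\}$ with grading $\|a\|=1$ and $\|b_i\|=z_i+1$ for $1\le i\le m$. Let $u,v\in\Gamma^*$ be words, let $n_i=|u\cdot v|_{b_i}$ for $1\le i\le m$, $\mathbf{n}=(n_1,\ldots,n_m)$, and suppose $\|u\|\geq \mathbf{n}\cdot\mathbf{z}+1$ and $\|v\|\geq \mathbf{n}\cdot\mathbf{z}+1$. Then there exist a nonempty prefix $x$ of $u$ and a nonempty prefix $y$ of $v$ such that $\|x\|=\|y\|$.
   Context: $\Gamma^*$ denotes the set of finite words over $\Gamma$. For a word $w=w_1\cdots w_n\in\Gamma^*$, its weight is $\|w\|=\|w_1\|+\cdots+\|w_n\|$, and $|w|_{b_i}$ denotes the number of occurrences of the letter $b_i$ in $w$. $u\cdot v$ denotes concatenation. For $\mathbf{n},\mathbf{z}\in\mathbb{N}^m$, $\mathbf{n}\cdot\mathbf{z}=n_1z_1+\cdots+n_mz_m$. A prefix of $w$ is a word $w_1\cdots w_j$ for some $0\le j\le n$ (nonempty means $j\ge 1$). -}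

module Defs where

open import Data.Nat using (ℕ; zero; suc; _+_; _*_; _≤_)
open import Data.Fin using (Fin)
open import Data.Fin.Properties using (_≟_)
open import Data.List using (List; []; _∷_; _++_; take; length)
open import Data.Product using (Σ; ∃; _×_)
open import Relation.Nullary using (yes; no)
open import Relation.Binary.PropositionalEquality using (_≡_)

-- The alphabet Γ = {a, b₁, …, bₘ}; b i for i : Fin m stands for b_{i+1}.
data Letter (m : ℕ) : Set where
  a : Letter m
  b : Fin m → Letter m

letterWeight : {m : ℕ} → (Fin m → ℕ) → Letter m → ℕ
letterWeight z a = 1
letterWeight z (b i) = suc (z i)

weight : {m : ℕ} → (Fin m → ℕ) → List (Letter m) → ℕ
weight z [] = 0
weight z (c ∷ w) = letterWeight z c + weight z w

count : {m : ℕ} → Fin m → List (Letter m) → ℕ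
count i [] = 0
count i (a ∷ w) = count i w
count i (b j ∷ w) with i ≟ j
... | yes _ = suc (count i w)
... | no _ = count i w

sumFin : (m : ℕ) → (Fin m → ℕ) → ℕ
sumFin zero f = 0
sumFin (suc m) f = f Fin.zero + sumFin m (λ i → f (Fin.suc i))

dot : (m : ℕ) → (Fin m → ℕ) → (Fin m → ℕ) → ℕ
dot m n z = sumFin m (λ i → n i * z i)

NonemptyPrefix : {A : Set} → List A → List A → Set
NonemptyPrefix x w = Σ ℕ (λ j → (1 ≤ j) × (j ≤ length w) × (x ≡ take j w))

-- Replace every letter c by its excess ‖c‖ ∸ 1 (0 for a, z_i for b_i); the total excess of u·v
-- is then n·z.  Compare the first letters of u and v: if they weigh the same we are done;
-- otherwise cut the lighter one off and shorten the heavier one by the same amount.  This keeps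
-- the hypothesis "total excess < total weight" on both sides, because the weight drops by x + 1
-- while the excess drops by 2x + 1.  The hypothesis keeps both words nonempty, so the process
-- ends with two first letters of equal weight.
module Submission where

open import Defs
open import Data.Nat using (ℕ; zero; suc; _+_; _*_; _≤_; _<_; z≤n; s≤s; compare; less; equal; greater)
open import Data.Nat.Properties
  using ( +-comm; +-assoc; +-suc; +-identityʳ; *-distribʳ-+; +-cancelˡ-≤; m≤n+m; ≤-trans; ≤-refl
        ; +-commutativeSemigroup)
open import Data.Nat.Tactic.RingSolver using (solve-∀)
open import Data.Fin using (Fin)
import Data.Fin as Fin
open import Data.Fin.Properties using (_≟_; suc-injective)
open import Data.List using (List; []; _∷_; _++_; take; length; map)
open import Data.Nat.ListAction using (sum)
open import Data.List.Properties using (take-map; length-map)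
open import Algebra.Properties.CommutativeSemigroup +-commutativeSemigroup using (interchange)
open import Data.Product using (Σ; _×_; _,_)
open import Data.Empty using (⊥-elim)
open import Function using (_∘_)
open import Relation.Nullary using (¬_; yes; no)
open import Relation.Binary.PropositionalEquality

private
  variable
    A B : Set

EqualWeightPrefixes : (List A → ℕ) → List A → List A → Set
EqualWeightPrefixes {A} ‖_‖ u v = Σ (List A) λ x → Σ (List A) λ y →
  NonemptyPrefix x u × NonemptyPrefix y v × ‖ x ‖ ≡ ‖ y ‖

equalWeightPrefixes-swap : {‖_‖ : List A → ℕ} {u v : List A} →
  EqualWeightPrefixes ‖_‖ u v → EqualWeightPrefixes ‖_‖ v u
equalWeightPrefixes-swap (x , y , px , py , eq) = y , x , py , px , sym eq

nonemptyPrefix-map⁻ : (f : A → B) {p : List B} (u : List A) → NonemptyPrefix p (map f u) →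
  Σ (List A) λ q → NonemptyPrefix q u × p ≡ map f q
nonemptyPrefix-map⁻ f u (j , 1≤j , j≤ , refl) =
  take j u , (j , 1≤j , subst (j ≤_) (length-map f u) j≤ , refl) , take-map j u

equalWeightPrefixes-map⁻ : (f : A → B) {‖_‖ᴬ : List A → ℕ} {‖_‖ᴮ : List B → ℕ} →
  (∀ w → ‖ w ‖ᴬ ≡ ‖ map f w ‖ᴮ) → {u v : List A} →
  EqualWeightPrefixes ‖_‖ᴮ (map f u) (map f v) → EqualWeightPrefixes ‖_‖ᴬ u v
equalWeightPrefixes-map⁻ f ‖‖-map {u} {v} (x , y , px , py , eq)
  with nonemptyPrefix-map⁻ f u px | nonemptyPrefix-map⁻ f v py
... | x′ , px′ , refl | y′ , py′ , refl =
  x′ , y′ , px′ , py′ , trans (‖‖-map x′) (trans eq (sym (‖‖-map y′)))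

-- A list of naturals encodes a word whose letters have weights suc x.
‖_‖ : List ℕ → ℕ
‖ xs ‖ = sum (map suc xs)

Admissible : List ℕ → List ℕ → Set
Admissible xs ys = sum xs + sum ys < ‖ xs ‖ × sum xs + sum ys < ‖ ys ‖

admissible-swap : (xs ys : List ℕ) → Admissible xs ys → Admissible ys xs
admissible-swap xs ys (hx , hy) rewrite +-comm (sum xs) (sum ys) = hy , hx

‖‖-split-head : ∀ x r t → suc (suc (x + r)) + t ≡ suc x + (suc r + t)
‖‖-split-head x r t = trans (cong (λ s → suc s + t) (sym (+-suc x r))) (+-assoc (suc x) (suc r) t)

admissible-descend : ∀ x r xs ys → Admissible (x ∷ xs) (suc (x + r) ∷ ys) → Admissible xs (r ∷ ys)
admissible-descend x r xs ys (hx , hy) =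
  cancel (subst (_< suc x + ‖ xs ‖) (excess-drop x r (sum xs) (sum ys)) hx) ,
  cancel (subst₂ _<_ (excess-drop x r (sum xs) (sum ys)) (‖‖-split-head x r ‖ ys ‖) hy)
  where
  excess-drop : ∀ x r s t → x + s + (suc (x + r) + t) ≡ suc x + (x + (s + (r + t)))
  excess-drop = solve-∀
  cancel : ∀ {s w} → suc x + (x + s) < suc x + w → s < w
  cancel {s} {w} h =
    ≤-trans (s≤s (m≤n+m s x))
            (+-cancelˡ-≤ (suc x) (suc (x + s)) w (subst (_≤ suc x + w) (sym (+-suc (suc x) (x + s))) h))

equalWeightPrefixes-descend : ∀ x r {xs ys} →
  EqualWeightPrefixes ‖_‖ xs (r ∷ ys) → EqualWeightPrefixes ‖_‖ (x ∷ xs) (suc (x + r) ∷ ys)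
equalWeightPrefixes-descend x r {xs} {ys}
  (.(take j xs) , .(r ∷ take k ys) , (j , _ , j≤ , refl) , (suc k , _ , s≤s k≤ , refl) , eq) =
  x ∷ take j xs , suc (x + r) ∷ take k ys ,
  (suc j , s≤s z≤n , s≤s j≤ , refl) , (suc k , s≤s z≤n , s≤s k≤ , refl) ,
  trans (cong (suc x +_) eq) (sym (‖‖-split-head x r ‖ take k ys ‖))

admissible-equalWeightPrefixes : (xs ys : List ℕ) → Admissible xs ys → EqualWeightPrefixes ‖_‖ xs ys
admissible-equalWeightPrefixes xs ys = go (length xs + length ys) xs ys ≤-refl
  where
  go : ∀ n xs ys → length xs + length ys ≤ n → Admissible xs ys → EqualWeightPrefixes ‖_‖ xs ys
  go n       []       ys       _ (() , _)
  go n       (x ∷ xs) []       _ (_ , ())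
  go (suc n) (x ∷ xs) (y ∷ ys) (s≤s len) adm with compare x y
  ... | equal .x =
    x ∷ [] , x ∷ [] ,
    (1 , s≤s z≤n , s≤s z≤n , refl) , (1 , s≤s z≤n , s≤s z≤n , refl) , refl
  ... | less .x r =
    equalWeightPrefixes-descend x r (go n xs (r ∷ ys) len (admissible-descend x r xs ys adm))
  ... | greater .y r =
    equalWeightPrefixes-swap (equalWeightPrefixes-descend y r
      (go n ys (r ∷ xs) (subst (_≤ n) (length-sum-swap (length xs) (length ys)) len)
        (admissible-descend y r ys xs (admissible-swap (suc (y + r) ∷ xs) (y ∷ ys) adm))))
    where
    length-sum-swap : ∀ p q → p + suc q ≡ q + suc p
    length-sum-swap p q = trans (+-suc p q) (trans (cong suc (+-comm p q)) (sym (+-suc q p)))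

sumFin-cong : ∀ m {f g : Fin m → ℕ} → (∀ i → f i ≡ g i) → sumFin m f ≡ sumFin m g
sumFin-cong zero    f≗g = refl
sumFin-cong (suc m) f≗g = cong₂ _+_ (f≗g Fin.zero) (sumFin-cong m (λ i → f≗g (Fin.suc i)))

sumFin-+ : ∀ m (f g : Fin m → ℕ) → sumFin m (λ i → f i + g i) ≡ sumFin m f + sumFin m g
sumFin-+ zero    f g = refl
sumFin-+ (suc m) f g =
  trans (cong (f Fin.zero + g Fin.zero +_) (sumFin-+ m (λ i → f (Fin.suc i)) (λ i → g (Fin.suc i))))
        (interchange (f Fin.zero) (g Fin.zero) _ _)

sumFin-zero : ∀ m (f : Fin m → ℕ) → (∀ i → f i ≡ 0) → sumFin m f ≡ 0
sumFin-zero zero    f f≡0 = refl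
sumFin-zero (suc m) f f≡0 =
  cong₂ _+_ (f≡0 Fin.zero) (sumFin-zero m (λ i → f (Fin.suc i)) (λ i → f≡0 (Fin.suc i)))

sumFin-single : ∀ m j (f : Fin m → ℕ) → (∀ i → ¬ i ≡ j → f i ≡ 0) → sumFin m f ≡ f j
sumFin-single (suc m) Fin.zero f f≡0 =
  trans (cong (f Fin.zero +_) (sumFin-zero m (λ i → f (Fin.suc i)) (λ i → f≡0 (Fin.suc i) λ ())))
        (+-identityʳ (f Fin.zero))
sumFin-single (suc m) (Fin.suc j) f f≡0 =
  cong₂ _+_ (f≡0 Fin.zero λ ())
            (sumFin-single m j (λ i → f (Fin.suc i)) (λ i i≢j → f≡0 (Fin.suc i) (i≢j ∘ suc-injective)))

count-++ : ∀ {m} (i : Fin m) u v → count i (u ++ v) ≡ count i u + count i v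
count-++ i []      v = refl
count-++ i (a ∷ u) v = count-++ i u v
count-++ i (b j ∷ u) v with i ≟ j
... | yes _ = cong suc (count-++ i u v)
... | no  _ = count-++ i u v

dot-count-++ : ∀ m (z : Fin m → ℕ) u v →
  dot m (λ i → count i (u ++ v)) z ≡ dot m (λ i → count i u) z + dot m (λ i → count i v) z
dot-count-++ m z u v =
  trans (sumFin-cong m λ i →
           trans (cong (_* z i) (count-++ i u v)) (*-distribʳ-+ (z i) (count i u) (count i v)))
        (sumFin-+ m _ _)

excess : ∀ {m} → (Fin m → ℕ) → Letter m → ℕ
excess z a     = 0
excess z (b i) = z i

dot-count-singleton : ∀ {m} (c : Letter m) (z : Fin m → ℕ) → dot m (λ i → count i (c ∷ [])) z ≡ excess z c
dot-count-singleton {m} a     z = sumFin-zero m _ (λ _ → refl)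
dot-count-singleton {m} (b j) z = trans (sumFin-single m j _ off-j) on-j
  where
  off-j : ∀ i → ¬ i ≡ j → count i (b j ∷ []) * z i ≡ 0
  off-j i i≢j with i ≟ j
  ... | yes i≡j = ⊥-elim (i≢j i≡j)
  ... | no  _   = refl
  on-j : count j (b j ∷ []) * z j ≡ z j
  on-j with j ≟ j
  ... | yes _   = +-identityʳ (z j)
  ... | no  j≢j = ⊥-elim (j≢j refl)

sum-excess : ∀ m (z : Fin m → ℕ) w → sum (map (excess z) w) ≡ dot m (λ i → count i w) z
sum-excess m z []      = sym (sumFin-zero m _ (λ _ → refl))
sum-excess m z (c ∷ w) = begin
  excess z c + sum (map (excess z) w)
    ≡⟨ cong₂ _+_ (sym (dot-count-singleton c z)) (sum-excess m z w) ⟩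
  dot m (λ i → count i (c ∷ [])) z + dot m (λ i → count i w) z
    ≡⟨ sym (dot-count-++ m z (c ∷ []) w) ⟩
  dot m (λ i → count i (c ∷ w)) z
    ∎
  where open ≡-Reasoning

weight-excess : ∀ {m} (z : Fin m → ℕ) w → weight z w ≡ ‖ map (excess z) w ‖
weight-excess z []        = refl
weight-excess z (a ∷ w)   = cong suc (weight-excess z w)
weight-excess z (b i ∷ w) = cong (suc (z i) +_) (weight-excess z w)

lemma2p1 : (m : ℕ) → 1 ≤ m → (z : Fin m → ℕ) → (u v : List (Letter m))
    → dot m (λ i → count i (u ++ v)) z + 1 ≤ weight z u
    → dot m (λ i → count i (u ++ v)) z + 1 ≤ weight z v
    → Σ (List (Letter m)) (λ x → Σ (List (Letter m)) (λ y →
        NonemptyPrefix x u × NonemptyPrefix y v × weight z x ≡ weight z y))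
lemma2p1 m _ z u v hu hv =
  equalWeightPrefixes-map⁻ (excess z) (weight-excess z)
    (admissible-equalWeightPrefixes (map (excess z) u) (map (excess z) v)
      ( subst₂ _≤_ total-excess (weight-excess z u) hu
      , subst₂ _≤_ total-excess (weight-excess z v) hv))
  where
  total-excess :
    dot m (λ i → count i (u ++ v)) z + 1 ≡ suc (sum (map (excess z) u) + sum (map (excess z) v))
  total-excess = begin
    dot m (λ i → count i (u ++ v)) z + 1
      ≡⟨ +-comm _ 1 ⟩
    suc (dot m (λ i → count i (u ++ v)) z)
      ≡⟨ cong suc (dot-count-++ m z u v) ⟩
    suc (dot m (λ i → count i u) z + dot m (λ i → count i v) z)
      ≡⟨ cong suc (cong₂ _+_ (sym (sum-excess m z u)) (sym (sum-excess m z v))) ⟩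
    suc (sum (map (excess z) u) + sum (map (excess z) v))
      ∎
    where open ≡-Reasoning
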